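{- For any two (not necessarily distinct) vertices $z,w$ of the graph $G_0$ (defined in the context) there exists a vertex $y_{z,w}$ of $G_0$ with $\deg_{G_0}(y_{z,w})=2$ such that $d(z,y_{z,w})+d(y_{z,w},w)\le 6$, where $d$ is the shortest-path distance in $G_0$.
   Context: The graph $H$ has 15 vertices $y_1,\dots,y_7,z_1,\dots,z_7,w$ and edges $y_1y_5, y_5y_6, y_6y_7, y_7y_3, y_3y_2, y_2y_1, y_2y_4, y_4y_6$, the analogous edges $z_1z_5, z_5z_6, z_6z_7, z_7z_3, z_3z_2, z_2z_1, z_2z_4, z_4z_6$, and the edges $y_4w, wz_4, y_3z_1, y_5z_7$. The graph $G_0$ is obtained from two disjoint copies $H^{(1)}, H^{(2)}$ of $H$ (the vertex of $H^{(j)}$ corresponding to $v\in V(H)$ is written $v^{(j)}$) by adding five new vertices $a,b,c,d,x$ and the edges: $a$ adjacent to $y_1^{(1)}$ and $y_1^{(2)}$; $b$ adjacent to $z_3^{(1)}$ and $z_3^{(2)}$; $c$ adjacent to $y_7^{(1)}$ and $z_5^{(2)}$; $d$ adjacent to $z_5^{(1)}$ and $y_7^{(2)}$; $x$ adjacent to $w^{(1)}$ and $w^{(2)}$. -}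

module Defs where

open import Data.Nat using (ℕ; zero; suc; _+_; _∸_; _<_)
open import Data.Nat.Properties using (_≟_)
open import Data.Fin using (Fin; toℕ)
open import Data.List using (List; []; _∷_; _++_; map; length; filter; allFin)
open import Data.List.Relation.Unary.Any using (Any; any?)
open import Data.Product using (_×_; _,_; Σ)
open import Data.Sum using (_⊎_)
open import Relation.Binary.PropositionalEquality using (_≡_)
open import Relation.Nullary using (¬_; Dec)
open import Relation.Nullary.Decidable using (_×-dec_; _⊎-dec_)

-- The graph H has 15 vertices, numbered as follows:
--   y_i ↦ i - 1      (i = 1..7, i.e. 0..6)
--   z_i ↦ 7 + i - 1  (i = 1..7, i.e. 7..13)
--   w   ↦ 14
-- In G₀, the copy H^(j) (j = 1,2) occupies 15*(j-1) .. 15*(j-1)+14,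
-- and a,b,c,d,x are 30,31,32,33,34.  So V(G₀) = Fin 35.

V : Set
V = Fin 35

yH zH : ℕ → ℕ
yH i = i ∸ 1
zH i = 7 + yH i

wH : ℕ
wH = 14

edgesH : List (ℕ × ℕ)
edgesH =
  (yH 1 , yH 5) ∷ (yH 5 , yH 6) ∷ (yH 6 , yH 7) ∷ (yH 7 , yH 3) ∷
  (yH 3 , yH 2) ∷ (yH 2 , yH 1) ∷ (yH 2 , yH 4) ∷ (yH 4 , yH 6) ∷
  (zH 1 , zH 5) ∷ (zH 5 , zH 6) ∷ (zH 6 , zH 7) ∷ (zH 7 , zH 3) ∷
  (zH 3 , zH 2) ∷ (zH 2 , zH 1) ∷ (zH 2 , zH 4) ∷ (zH 4 , zH 6) ∷
  (yH 4 , wH) ∷ (wH , zH 4) ∷ (yH 3 , zH 1) ∷ (yH 5 , zH 7) ∷ []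

c1 c2 : ℕ → ℕ
c1 v = v
c2 v = 15 + v

aV bV cV dV xV : ℕ
aV = 30
bV = 31
cV = 32
dV = 33
xV = 34

shift : (ℕ → ℕ) → ℕ × ℕ → ℕ × ℕ
shift f (u , v) = (f u , f v)

edgesG₀ : List (ℕ × ℕ)
edgesG₀ =
  map (shift c1) edgesH ++ map (shift c2) edgesH ++
  ( (aV , c1 (yH 1)) ∷ (aV , c2 (yH 1)) ∷
    (bV , c1 (zH 3)) ∷ (bV , c2 (zH 3)) ∷
    (cV , c1 (yH 7)) ∷ (cV , c2 (zH 5)) ∷
    (dV , c1 (zH 5)) ∷ (dV , c2 (yH 7)) ∷
    (xV , c1 wH)     ∷ (xV , c2 wH)     ∷ [])

EdgeIn : ℕ → ℕ → (ℕ × ℕ) → Set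
EdgeIn u v (p , q) = (p ≡ u × q ≡ v) ⊎ (p ≡ v × q ≡ u)

Adj : V → V → Set
Adj u v = Any (EdgeIn (toℕ u) (toℕ v)) edgesG₀

Adj? : (u v : V) → Dec (Adj u v)
Adj? u v = any? (λ { (p , q) → ((p ≟ toℕ u) ×-dec (q ≟ toℕ v)) ⊎-dec ((p ≟ toℕ v) ×-dec (q ≟ toℕ u)) }) edgesG₀

deg : V → ℕ
deg u = length (filter (Adj? u) (allFin 35))

data Walk : V → V → ℕ → Set where
  here : ∀ {u} → Walk u u 0
  step : ∀ {u v t k} → Adj u v → Walk v t k → Walk u t (suc k)

IsDist : V → V → ℕ → Set
IsDist u v k = Walk u v k × (∀ j → j < k → ¬ Walk u v j)

module Submission where

open import Defs
open import Data.Nat using (ℕ; _+_; _≤_)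
open import Data.Product using (_×_; Σ; ∃)
open import Relation.Binary.PropositionalEquality using (_≡_)

open import Data.Bool using (if_then_else_)
open import Data.Nat using (zero; suc; _⊓_; _≤?_; s≤s)
open import Data.Nat.Properties using (≤-trans; ≤-reflexive; <⇒≱) renaming (_≟_ to _≟ℕ_)
open import Data.Fin using (#_)
open import Data.Fin.Properties using (all?) renaming (_≟_ to _≟ᶠ_)
open import Data.List using (List; []; _∷_; filter; allFin; foldr)
open import Data.List.Relation.Unary.All as All using (All; []; _∷_)
open import Data.List.Relation.Unary.Any using (Any; any?)
open import Data.List.Membership.Propositional using (_∈_; find)
open import Data.List.Membership.Propositional.Properties using (∈-allFin; ∈-filter⁺; ∈-filter⁻)
open import Data.Product using (_,_; proj₁; proj₂)
open import Data.Vec using (Vec; lookup; tabulate)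
open import Data.Vec.Properties using (lookup∘tabulate)
open import Relation.Nullary using (Dec; does)
open import Relation.Nullary.Decidable using (toWitness; _×-dec_)
open import Relation.Binary.PropositionalEquality using (refl; subst)

-- The vertices a, b, c, d, x (numbered 30..34) have degree 2,
-- and every pair z, w of vertices has one of them "between" them, at total
-- distance at most 6.  Shortest-path distances are certified, not searched:
-- a function f : V → ℕ is the distance to t as soon as
--   * f t = 0 and f a ≤ 1 + f b along every edge    (so no walk to t is shorter), and
--   * f u = 0 only at t, and f u = k + 1 implies a neighbour with f = k
--                                                     (so a walk of length f u exists).
-- A candidate distance table is computed by Bellman-Ford style relaxation;
-- one decision procedure then confirms both that the table is certified and
-- that every pair z, w is covered by a hub.  lemma4 reads off the hub.

N : V → List V
N u = filter (Adj? u) (allFin 35)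

∈N⇒Adj : ∀ {u n} → n ∈ N u → Adj u n
∈N⇒Adj {u} n∈N = proj₂ (∈-filter⁻ (Adj? u) n∈N)

Adj⇒∈N : ∀ {u n} → Adj u n → n ∈ N u
Adj⇒∈N {u} {n} u~n = ∈-filter⁺ (Adj? u) (∈-allFin n) u~n

record DistanceCertificate (t : V) (f : V → ℕ) : Set where
  field
    vanishes       : f t ≡ 0
    lipschitz      : ∀ {a b} → Adj a b → f a ≤ suc (f b)
    only-at-target : ∀ {u} → f u ≡ 0 → u ≡ t
    descends       : ∀ {u k} → f u ≡ suc k → ∃ λ n → Adj u n × f n ≡ k

module _ {t : V} {f : V → ℕ} (cert : DistanceCertificate t f) where
  open DistanceCertificate cert

  -- f decreases by at most one per step, so it bounds every walk to t from below.
  walk-lower-bound : ∀ {u j} → Walk u t j → f u ≤ j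
  walk-lower-bound here         = ≤-reflexive vanishes
  walk-lower-bound (step u~v w) = ≤-trans (lipschitz u~v) (s≤s (walk-lower-bound w))

  descending-walk : ∀ k {u} → f u ≡ k → Walk u t k
  descending-walk zero    fu≡0 with only-at-target fu≡0
  ... | refl = here
  descending-walk (suc k) fu≡1+k with descends fu≡1+k
  ... | n , u~n , fn≡k = step u~n (descending-walk k fn≡k)

  certified-distance : ∀ u → IsDist u t (f u)
  certified-distance u =
    descending-walk (f u) refl , λ j j<fu w → <⇒≱ j<fu (walk-lower-bound w)

-- Local form of the certificate, stated against a table A of neighbourhood
-- lists so that it can be decided vertex by vertex.

Neighbourhoods : Set
Neighbourhoods = Vec (List V) 35

neighbourhoods : Neighbourhoods
neighbourhoods = tabulate N

Descent : List V → (t : V) (f : V → ℕ) (u : V) → ℕ → Set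
Descent nbrs t f u zero    = u ≡ t
Descent nbrs t f u (suc k) = Any (λ n → f n ≡ k) nbrs

descent? : ∀ nbrs t f u k → Dec (Descent nbrs t f u k)
descent? nbrs t f u zero    = u ≟ᶠ t
descent? nbrs t f u (suc k) = any? (λ n → f n ≟ℕ k) nbrs

LocallyCertified : Neighbourhoods → (t : V) (f : V → ℕ) → Set
LocallyCertified A t f =
  f t ≡ 0 ×
  (∀ u → All (λ n → f u ≤ suc (f n)) (lookup A u) × Descent (lookup A u) t f u (f u))

locally-certified? : ∀ A t f → Dec (LocallyCertified A t f)
locally-certified? A t f =
  (f t ≟ℕ 0) ×-dec
  all? (λ u → All.all? (λ n → f u ≤? suc (f n)) (lookup A u)
              ×-dec descent? (lookup A u) t f u (f u))

local⇒certificate : ∀ {t f} → LocallyCertified neighbourhoods t f → DistanceCertificate t f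
local⇒certificate {t} {f} (ft≡0 , local) = record
  { vanishes       = ft≡0
  ; lipschitz      = λ {a} a~b →
      All.lookup (proj₁ (local a)) (subst (_ ∈_) (N≡table a) (Adj⇒∈N a~b))
  ; only-at-target = λ {u} fu≡0 → descent-at u fu≡0
  ; descends       = λ {u} fu≡1+k → neighbour-below u (descent-at u fu≡1+k)
  }
  where
  N≡table : ∀ u → N u ≡ lookup neighbourhoods u
  N≡table u rewrite lookup∘tabulate N u = refl

  descent-at : ∀ u {k} → f u ≡ k → Descent (lookup neighbourhoods u) t f u k
  descent-at u fu≡k = subst (Descent (lookup neighbourhoods u) t f u) fu≡k (proj₂ (local u))

  neighbour-below : ∀ u {k} → Any (λ n → f n ≡ k) (lookup neighbourhoods u) →
                    ∃ λ n → Adj u n × f n ≡ k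
  neighbour-below u below with find below
  ... | n , n∈ , fn≡k = n , ∈N⇒Adj (subst (n ∈_) (lookup∘tabulate N u) n∈) , fn≡k

-- Row t of a table lists the values f u = dist u t.
-- Relaxation from the indicator of t (with 35 standing for "unreached")
-- produces them; 6 rounds suffice because G₀ has diameter 6, and in any
-- case the result is only trusted after it has been certified.

Table : Set
Table = Vec (Vec ℕ 35) 35

dist : Table → V → V → ℕ
dist M u t = lookup (lookup M t) u

relax : Neighbourhoods → Vec ℕ 35 → Vec ℕ 35
relax A d = tabulate (λ v → foldr (λ n m → m ⊓ suc (lookup d n)) (lookup d v) (lookup A v))

relax-rounds : ℕ → Neighbourhoods → Vec ℕ 35 → Vec ℕ 35
relax-rounds zero    A d = d
relax-rounds (suc r) A d = relax-rounds r A (relax A d)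

distances : Neighbourhoods → Table
distances A = tabulate (λ t → relax-rounds 6 A (tabulate (λ v → if does (v ≟ᶠ t) then 0 else 35)))

hubs : List V
hubs = # 30 ∷ # 31 ∷ # 32 ∷ # 33 ∷ # 34 ∷ []

hubs-have-degree-2 : All (λ y → deg y ≡ 2) hubs
hubs-have-degree-2 = refl ∷ refl ∷ refl ∷ refl ∷ refl ∷ []

Covered : Table → Set
Covered M = ∀ z w → Any (λ y → dist M z y + dist M y w ≤ 6) hubs

-- The whole finite verification, decided once: the table is certified for
-- every target and covers every pair.  (The table is passed as an argument
-- so that it is computed only once.)
Valid : Neighbourhoods → Table → Set
Valid A M = (∀ t → LocallyCertified A t (λ u → dist M u t)) × Covered M

valid? : ∀ A M → Dec (Valid A M)
valid? A M =
  all? (λ t → locally-certified? A t (λ u → dist M u t)) ×-dec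
  all? (λ z → all? (λ w → any? (λ y → dist M z y + dist M y w ≤? 6) hubs))

-- Opaque, so that neither the table nor the (large) evidence is ever
-- unfolded by later checks.
opaque
  G₀-distances : Table
  G₀-distances = distances neighbourhoods

  valid : Valid neighbourhoods G₀-distances
  valid = toWitness {a? = valid? neighbourhoods G₀-distances} _

distance : ∀ u t → IsDist u t (dist G₀-distances u t)
distance u t = certified-distance (local⇒certificate (proj₁ valid t)) u

lemma4 : (z w : V) → Σ V (λ y → deg y ≡ 2 × Σ ℕ (λ k → Σ ℕ (λ l → IsDist z y k × IsDist y w l × k + l ≤ 6)))
lemma4 z w with find (proj₂ valid z w)
... | y , y∈hubs , short =
  y , All.lookup hubs-have-degree-2 y∈hubs ,
  dist G₀-distances z y , dist G₀-distances y w ,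
  distance z y , distance y w , short
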